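{- Let $X=\{x_i\}_{i=0}^N$ and $Y=\{y_j\}_{j=0}^M$ be two convex sequences of real numbers, and suppose there are indices $u$ and $v$ such that $[x_u,x_{u+1}] \subset [y_v,y_{v+1}]$. Then $Z := \{x_i\}_{i=0}^{u} \cup \{y_j\}_{j=v+1}^{M}$ is a convex sequence.
   Context: A sequence of real numbers $a_0 < a_1 < \dots < a_N$ (indexed in increasing order) is called convex if the gaps between consecutive elements are strictly increasing: $a_1-a_0 < a_2-a_1 < \dots < a_N-a_{N-1}$. -}

module Defs where

open import Level using (Level; _⊔_) renaming (suc to lsuc)
open import Data.Nat as ℕ using (ℕ; suc; _∸_; _≤?_)
open import Relation.Nullary using (yes; no)
open import Data.Sum using (_⊎_)
open import Relation.Binary using (Rel; IsStrictTotalOrder)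
open import Algebra.Bundles using (CommutativeRing)

-- The real numbers are an instance; stdlib has no reals.
record OrderedCommutativeRing (c ℓ₁ ℓ₂ : Level) : Set (lsuc (c ⊔ ℓ₁ ⊔ ℓ₂)) where
  field
    commRing : CommutativeRing c ℓ₁
  open CommutativeRing commRing public
  infix 4 _<_ _≤_
  field
    _<_         : Rel Carrier ℓ₂
    isSTO       : IsStrictTotalOrder _≈_ _<_
    +-mono-<    : ∀ {x y} z → x < y → x + z < y + z
    *-pos       : ∀ {x y} → 0# < x → 0# < y → 0# < x * y
  _≤_ : Rel Carrier (ℓ₁ ⊔ ℓ₂)
  x ≤ y = (x < y) ⊎ (x ≈ y)

module _ {c ℓ₁ ℓ₂} (R : OrderedCommutativeRing c ℓ₁ ℓ₂) where
  open OrderedCommutativeRing R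
  open import Data.Product using (_×_)

  -- a_0 < a_1 < ... < a_N with a_1 - a_0 < a_2 - a_1 < ... < a_N - a_{N-1}.
  -- The sequence is a function ℕ → Carrier; only indices 0..N matter.
  Convex : ℕ → (ℕ → Carrier) → Set ℓ₂
  Convex N a =
    (∀ i → i ℕ.< N → a i < a (suc i)) ×
    (∀ i → suc (suc i) ℕ.≤ N → a (suc i) - a i < a (suc (suc i)) - a (suc i))

-- Z = {x_0,...,x_u} ∪ {y_{v+1},...,y_M}, listed in order:
-- z_k = x_k for k ≤ u, and z_k = y_{v + (k - u)} for k > u
-- (so z_{u+1} = y_{v+1}); its last index is u + (M - v).
join : ∀ {a} {A : Set a} → ℕ → ℕ → (ℕ → A) → (ℕ → A) → ℕ → A
join u v x y k with k ≤? u
... | yes _ = x k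
... | no  _ = y (v ℕ.+ (k ∸ u))

module Submission where

open import Defs
open import Data.Nat as ℕ using (ℕ; zero; suc; _∸_)
import Data.Nat.Properties as ℕ
open import Data.Product using (_,_; proj₁; proj₂)
open import Data.Sum using (inj₁; inj₂)
open import Relation.Nullary using (yes; no; contradiction)
open import Relation.Binary using (IsStrictTotalOrder)
open import Relation.Binary.PropositionalEquality as ≡ using (_≡_; refl)
import Algebra.Properties.Group as GroupProperties
import Relation.Binary.Construct.StrictToNonStrict as StrictToNonStrict

-- Z is convex away from the seam because X and Y are. At the seam the two
-- new gaps are squeezed by the hypothesis [x_u, x_{u+1}] ⊆ [y_v, y_{v+1}]:
--   x_u - x_{u-1} < x_{u+1} - x_u ≤ y_{v+1} - x_u ≤ y_{v+1} - y_v < y_{v+2} - y_{v+1}.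

module OrderedCommutativeRingProperties
  {c ℓ₁ ℓ₂} (R : OrderedCommutativeRing c ℓ₁ ℓ₂) where

  open OrderedCommutativeRing R
  open IsStrictTotalOrder isSTO using (<-respʳ-≈; <-respˡ-≈) renaming (trans to <-trans)
  open GroupProperties +-group using (\\-leftDividesˡ)
  open StrictToNonStrict _≈_ _<_ using (≤-respˡ-≈; ≤-respʳ-≈)

  <-≤-trans : ∀ {x y z} → x < y → y ≤ z → x < z
  <-≤-trans = StrictToNonStrict.<-≤-trans _≈_ _<_ <-trans <-respʳ-≈

  ≤-<-trans : ∀ {x y z} → x ≤ y → y < z → x < z
  ≤-<-trans = StrictToNonStrict.≤-<-trans _≈_ _<_ sym <-trans <-respˡ-≈

  +-monoˡ-≤ : ∀ {x y} z → x ≤ y → x + z ≤ y + z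
  +-monoˡ-≤ z (inj₁ x<y) = inj₁ (+-mono-< z x<y)
  +-monoˡ-≤ z (inj₂ x≈y) = inj₂ (+-congʳ x≈y)

  +-monoʳ-≤ : ∀ {x y} z → x ≤ y → z + x ≤ z + y
  +-monoʳ-≤ {x} {y} z x≤y =
    ≤-respʳ-≈ trans <-respʳ-≈ (+-comm y z)
      (≤-respˡ-≈ sym trans <-respˡ-≈ (+-comm x z) (+-monoˡ-≤ z x≤y))

  -- Adding -x + -y to both sides of x < y.
  neg-antimono-< : ∀ {x y} → x < y → - y < - x
  neg-antimono-< {x} {y} x<y =
    <-respʳ-≈ y+[-x+-y]≈-x (<-respˡ-≈ (\\-leftDividesˡ x (- y)) (+-mono-< (- x + - y) x<y))
    where
    y+[-x+-y]≈-x : y + (- x + - y) ≈ - x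
    y+[-x+-y]≈-x = trans (+-congˡ (+-comm (- x) (- y))) (\\-leftDividesˡ y (- x))

  neg-antimono-≤ : ∀ {x y} → x ≤ y → - y ≤ - x
  neg-antimono-≤ (inj₁ x<y) = inj₁ (neg-antimono-< x<y)
  neg-antimono-≤ (inj₂ x≈y) = inj₂ (-‿cong (sym x≈y))

data Position (u : ℕ) : ℕ → Set where
  below : ∀ {i} → i ℕ.< u → Position u i
  at    : Position u u
  past  : ∀ d → Position u (suc d ℕ.+ u)

position : ∀ u i → Position u i
position u i with i ℕ.<? u
... | yes i<u = below i<u
... | no  i≮u with i ∸ u | ℕ.m∸n+n≡m (ℕ.≮⇒≥ i≮u)
...   | zero  | refl = at
...   | suc d | refl = past d

module _ {a} {A : Set a} (u v : ℕ) (x y : ℕ → A) where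

  join-≤ : ∀ {k} → k ℕ.≤ u → join u v x y k ≡ x k
  join-≤ {k} k≤u with k ℕ.≤? u
  ... | yes _   = refl
  ... | no  k≰u = contradiction k≤u k≰u

  join-past : ∀ d → join u v x y (suc d ℕ.+ u) ≡ y (suc d ℕ.+ v)
  join-past d with suc d ℕ.+ u ℕ.≤? u
  ... | yes 1+d+u≤u = contradiction 1+d+u≤u (ℕ.<⇒≱ (ℕ.s≤s (ℕ.m≤n+m u d)))
  ... | no  _     = ≡.cong y (≡.trans (≡.cong (v ℕ.+_) (ℕ.m+n∸n≡m (suc d) u)) (ℕ.+-comm v (suc d)))

past-index-< : ∀ {u v M} d → v ℕ.≤ M → d ℕ.+ u ℕ.< u ℕ.+ (M ∸ v) → d ℕ.+ v ℕ.< M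
past-index-< {u} {v} {M} d v≤M d+u<u+[M∸v] =
  ≡.subst (d ℕ.+ v ℕ.<_) (ℕ.m∸n+n≡m v≤M)
    (ℕ.+-monoˡ-< v (ℕ.+-cancelʳ-< u d (M ∸ v) (≡.subst (d ℕ.+ u ℕ.<_) (ℕ.+-comm u (M ∸ v)) d+u<u+[M∸v])))

module Splice {c ℓ₁ ℓ₂} (R : OrderedCommutativeRing c ℓ₁ ℓ₂)
  {N M : ℕ} {x y : ℕ → OrderedCommutativeRing.Carrier R}
  (X : Convex R N x) (Y : Convex R M y) {v : ℕ} (v<M : v ℕ.< M) where

  open OrderedCommutativeRing R
  open OrderedCommutativeRingProperties R

  Δ : (ℕ → Carrier) → ℕ → Carrier
  Δ a i = a (suc i) - a i

  join-increasing : ∀ u → u ℕ.< N → x (suc u) ≤ y (suc v) →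
                    ∀ i → i ℕ.< u ℕ.+ (M ∸ v) → join u v x y i < join u v x y (suc i)
  join-increasing u u<N xᵤ₊₁≤yᵥ₊₁ i i<L with position u i
  ... | below i<u
    rewrite join-≤ u v x y (ℕ.<⇒≤ i<u) | join-≤ u v x y i<u
    = proj₁ X i (ℕ.<-trans i<u u<N)
  ... | at
    rewrite join-≤ u v x y ℕ.≤-refl | join-past u v x y 0
    = <-≤-trans (proj₁ X u u<N) xᵤ₊₁≤yᵥ₊₁
  ... | past d
    rewrite join-past u v x y d | join-past u v x y (suc d)
    = proj₁ Y (suc d ℕ.+ v) (past-index-< (suc d) (ℕ.<⇒≤ v<M) i<L)

  join-gaps-increasing : ∀ u → u ℕ.< N → y v ≤ x u → x (suc u) ≤ y (suc v) →
                         ∀ i → suc (suc i) ℕ.≤ u ℕ.+ (M ∸ v) →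
                         Δ (join u v x y) i < Δ (join u v x y) (suc i)
  join-gaps-increasing u u<N yᵥ≤xᵤ xᵤ₊₁≤yᵥ₊₁ i i+2≤L with position u (suc i)
  ... | below i+1<u
    rewrite join-≤ u v x y (ℕ.<⇒≤ (ℕ.<-trans (ℕ.n<1+n i) i+1<u))
          | join-≤ u v x y (ℕ.<⇒≤ i+1<u) | join-≤ u v x y i+1<u
    = proj₂ X i (ℕ.≤-trans i+1<u (ℕ.<⇒≤ u<N))
  ... | at
    rewrite join-≤ u v x y (ℕ.n≤1+n i) | join-≤ u v x y ℕ.≤-refl | join-past u v x y 0
    = <-≤-trans (proj₂ X i u<N) (+-monoˡ-≤ (- x (suc i)) xᵤ₊₁≤yᵥ₊₁)
  ... | past zero
    rewrite join-≤ u v x y ℕ.≤-refl | join-past u v x y 0 | join-past u v x y 1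
    = ≤-<-trans (+-monoʳ-≤ (y (suc v)) (neg-antimono-≤ yᵥ≤xᵤ))
                (proj₂ Y v (past-index-< 1 (ℕ.<⇒≤ v<M) i+2≤L))
  ... | past (suc d)
    rewrite join-past u v x y d | join-past u v x y (suc d) | join-past u v x y (suc (suc d))
    = proj₂ Y (suc d ℕ.+ v) (past-index-< (suc (suc d)) (ℕ.<⇒≤ v<M) i+2≤L)

lemma1 : ∀ {c ℓ₁ ℓ₂} (R : OrderedCommutativeRing c ℓ₁ ℓ₂) →
         let open OrderedCommutativeRing R in
         (N M : ℕ) (x y : ℕ → Carrier) →
         Convex R N x → Convex R M y →
         (u v : ℕ) → u ℕ.< N → v ℕ.< M →
         y v ≤ x u → x (suc u) ≤ y (suc v) →
         Convex R (u ℕ.+ (M ∸ v)) (join u v x y)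
lemma1 R N M x y X Y u v u<N v<M yᵥ≤xᵤ xᵤ₊₁≤yᵥ₊₁ =
  join-increasing u u<N xᵤ₊₁≤yᵥ₊₁ , join-gaps-increasing u u<N yᵥ≤xᵤ xᵤ₊₁≤yᵥ₊₁
  where open Splice R X Y v<M
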